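{- Let $a,b$ be integers with $a-1>b\ge 1$, let $\varphi(0)=0^a1$, $\varphi(1)=0^b1$, let $u_\beta=\lim_{n\to\infty}\varphi^n(0)$, let $T(w)=0^b1\varphi(w)0^b$, and define $U^{(1)}=0^{a-1}$ and $U^{(n)}=T(U^{(n-1)})$ for $n\ge 2$. Let $p$ be a palindrome in ${\cal L}(u_\beta)$. Then $p$ is a maximal palindrome if and only if $p=U^{(n)}$ for some positive integer $n$.
   Context: ${\cal L}(u_\beta)$ is the set of finite factors of $u_\beta$. A word $w$ is a palindrome if it equals its reversal. A palindrome $p\in{\cal L}(u_\beta)$ is maximal if neither $0p0$ nor $1p1$ belongs to ${\cal L}(u_\beta)$. -}

module Defs where

open import Data.Nat using (ℕ; zero; suc; _∸_; _+_)
open import Data.List using (List; []; _∷_; _++_; replicate; concatMap; reverse; length; lookup)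
open import Data.Fin using (Fin; toℕ)
open import Data.Product using (∃-syntax; _×_)
open import Relation.Binary.PropositionalEquality using (_≡_)
open import Relation.Nullary using (¬_)

data Letter : Set where
  𝟘 𝟙 : Letter

Word : Set
Word = List Letter

φ₁ : ℕ → ℕ → Letter → Word
φ₁ a b 𝟘 = replicate a 𝟘 ++ 𝟙 ∷ []
φ₁ a b 𝟙 = replicate b 𝟘 ++ 𝟙 ∷ []

φ : ℕ → ℕ → Word → Word
φ a b w = concatMap (φ₁ a b) w

φ^ : ℕ → ℕ → ℕ → Word → Word
φ^ a b zero w = w
φ^ a b (suc n) w = φ a b (φ^ a b n w)

lookupDefault : Word → ℕ → Letter
lookupDefault [] i = 𝟘
lookupDefault (x ∷ w) zero = x
lookupDefault (x ∷ w) (suc i) = lookupDefault w i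

-- Since φ(0) begins with 0, φ^n(0) is a prefix of φ^(n+1)(0), and
-- |φ^(i+1)(0)| > i, so the i-th letter of u_β is the i-th letter of φ^(i+1)(0)
-- (the default in lookupDefault is never reached).
uβ : ℕ → ℕ → ℕ → Letter
uβ a b i = lookupDefault (φ^ a b (suc i) (𝟘 ∷ [])) i

FactorOf : (ℕ → Letter) → Word → Set
FactorOf u w = ∃[ i ] ((j : Fin (length w)) → u (i + toℕ j) ≡ lookup w j)

InL : ℕ → ℕ → Word → Set
InL a b w = FactorOf (uβ a b) w

Palindrome : Word → Set
Palindrome w = reverse w ≡ w

MaximalPalindrome : ℕ → ℕ → Word → Set
MaximalPalindrome a b p =
  Palindrome p × InL a b p ×
  ¬ InL a b (𝟘 ∷ p ++ 𝟘 ∷ []) × ¬ InL a b (𝟙 ∷ p ++ 𝟙 ∷ [])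

T : ℕ → ℕ → Word → Word
T a b w = replicate b 𝟘 ++ 𝟙 ∷ (φ a b w ++ replicate b 𝟘)

-- U^(1) = 0^(a-1), U^(n) = T(U^(n-1)) for n ≥ 2.
-- U 0 is a dummy value; only n ≥ 1 is used.
U : ℕ → ℕ → ℕ → Word
U a b zero = []
U a b (suc zero) = replicate (a ∸ 1) 𝟘
U a b (suc (suc n)) = T a b (U a b (suc n))

{-# OPTIONS --safe #-}
module Submission where

-- Every factor of u_β occurs in φ(v) for a factor v, and φ(v) splits uniquely into blocks 𝟘^a 𝟙 and
-- 𝟘^b 𝟙. In a factor c 𝟘^i 𝟙 or 𝟙 𝟘^i d the run 𝟘^i ends, resp. starts, a block, so for i ≠ b the
-- letter c (resp. d) is 𝟙 exactly when i = a. Hence a palindrome 𝟘^i 𝟙 … 𝟙 𝟘^i with i ≠ b extends to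
-- c p c and is not maximal, while one with i = b has the form T(q), q a palindrome. Desubstituting shows
-- that c T(q) d is a factor iff c q d is one, so T preserves and reflects maximality, and induction on
-- the length leaves the palindromes 𝟘^m, of which only 𝟘^(a-1) is maximal.

open import Defs
open import Data.Nat using (ℕ; zero; suc; _≤_; _<_; _+_; _∸_; _≤′_; ≤′-reflexive; ≤′-step; z≤n; s≤s)
open import Data.Nat.Induction using (<-wellFounded)
open import Data.Nat.Properties
open import Data.List using ([]; _∷_; _++_; [_]; _∷ʳ_; replicate; reverse; length; lookup; initLast; _∷ʳ′_)
open import Data.List.Properties
  using (++-assoc; ++-identityʳ; ++-cancelˡ; ++-cancelʳ; ++-conicalˡ; ++-conicalʳ; ++-monoid; concatMap-++;
         length-++; length-++-≤ˡ; reverse-++; unfold-reverse; ∷-injectiveʳ)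
open import Data.Fin using (Fin; toℕ; zero; suc)
open import Data.Fin.Properties using (toℕ<n)
open import Data.Product using (∃-syntax; _×_; _,_; map₂)
open import Data.Sum using (_⊎_; inj₁; inj₂; map₁)
open import Data.Empty using (⊥-elim)
open import Function using (id; _∘_; _on_)
open import Induction.WellFounded using (Acc; acc)
open import Relation.Binary.Construct.On using (wellFounded)
open import Relation.Binary.PropositionalEquality
  using (_≡_; _≢_; refl; sym; trans; cong; cong₂; subst; module ≡-Reasoning)
open import Relation.Nullary using (¬_)
open import Algebra.Solver.Monoid (++-monoid Letter) using (solve; _⊜_; _⊕_)

𝟘^_ : ℕ → Word
𝟘^ k = replicate k 𝟘

𝟘^-+ : ∀ m n → 𝟘^ (m + n) ≡ 𝟘^ m ++ 𝟘^ n
𝟘^-+ zero    n = refl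
𝟘^-+ (suc m) n = cong (𝟘 ∷_) (𝟘^-+ m n)

𝟘^-∷ʳ : ∀ n → 𝟘^ n ∷ʳ 𝟘 ≡ 𝟘 ∷ 𝟘^ n
𝟘^-∷ʳ zero    = refl
𝟘^-∷ʳ (suc n) = cong (𝟘 ∷_) (𝟘^-∷ʳ n)

𝟘∷𝟘^-∷ʳ𝟘 : ∀ m → 𝟘 ∷ 𝟘^ m ++ [ 𝟘 ] ≡ 𝟘^ (suc (suc m))
𝟘∷𝟘^-∷ʳ𝟘 m = cong (𝟘 ∷_) (𝟘^-∷ʳ m)

reverse-𝟘^ : ∀ n → reverse (𝟘^ n) ≡ 𝟘^ n
reverse-𝟘^ zero    = refl
reverse-𝟘^ (suc n) = begin
  reverse (𝟘 ∷ 𝟘^ n)  ≡⟨ unfold-reverse 𝟘 (𝟘^ n) ⟩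
  reverse (𝟘^ n) ∷ʳ 𝟘 ≡⟨ cong (_∷ʳ 𝟘) (reverse-𝟘^ n) ⟩
  𝟘^ n ∷ʳ 𝟘           ≡⟨ 𝟘^-∷ʳ n ⟩
  𝟘 ∷ 𝟘^ n            ∎
  where open ≡-Reasoning

reverse-++-∷ : ∀ xs (c : Letter) ys → reverse (xs ++ c ∷ ys) ≡ reverse ys ++ c ∷ reverse xs
reverse-++-∷ xs c ys = begin
  reverse (xs ++ c ∷ ys)          ≡⟨ reverse-++ xs (c ∷ ys) ⟩
  reverse (c ∷ ys) ++ reverse xs  ≡⟨ cong (_++ reverse xs) (unfold-reverse c ys) ⟩
  (reverse ys ∷ʳ c) ++ reverse xs ≡⟨ ++-assoc (reverse ys) [ c ] (reverse xs) ⟩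
  reverse ys ++ c ∷ reverse xs    ∎
  where open ≡-Reasoning

reverse-𝟘^-++-∷ : ∀ j c t → reverse (𝟘^ j ++ c ∷ t) ≡ reverse t ++ c ∷ 𝟘^ j
reverse-𝟘^-++-∷ j c t = trans (reverse-++-∷ (𝟘^ j) c t) (cong (λ z → reverse t ++ c ∷ z) (reverse-𝟘^ j))

++-∷-≢[] : ∀ xs {y : Letter} {ys} → xs ++ y ∷ ys ≢ []
++-∷-≢[] []      ()
++-∷-≢[] (_ ∷ _) ()

Factor : Word → Word → Set
Factor w v = ∃[ x ] ∃[ y ] (v ≡ x ++ w ++ y)

factor-refl : ∀ w → Factor w w
factor-refl w = [] , [] , sym (++-identityʳ w)

factor-trans : ∀ {u v w} → Factor u v → Factor v w → Factor u w
factor-trans {u} (x , y , refl) (x′ , y′ , refl) = x′ ++ x , y ++ y′ ,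
  solve 5 (λ x′ x u y y′ → x′ ⊕ (x ⊕ u ⊕ y) ⊕ y′ ⊜ (x′ ⊕ x) ⊕ u ⊕ (y ⊕ y′)) refl x′ x u y y′

factor-extend : ∀ {w} x y → x ≢ [] → y ≢ [] → ∃[ c ] ∃[ d ] Factor (c ∷ w ++ [ d ]) (x ++ w ++ y)
factor-extend     x []      _    y≢[] = ⊥-elim (y≢[] refl)
factor-extend {w} x (d ∷ y) x≢[] _    with initLast x
... | []       = ⊥-elim (x≢[] refl)
... | x′ ∷ʳ′ c = c , d , x′ , y ,
  solve 5 (λ x′ c w d y → (x′ ⊕ c) ⊕ w ⊕ d ⊕ y ⊜ x′ ⊕ (c ⊕ w ⊕ d) ⊕ y) refl x′ [ c ] w [ d ] y

-- RunEdge c j k says that c is the letter at position j of 𝟘^ k ++ [ 𝟙 ].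
RunEdge : Letter → ℕ → ℕ → Set
RunEdge 𝟘 j k = j < k
RunEdge 𝟙 j k = j ≡ k

RunEdge-suc : ∀ c {j k} → RunEdge c j k → RunEdge c (suc j) (suc k)
RunEdge-suc 𝟘 = s≤s
RunEdge-suc 𝟙 = cong suc

run-edge : ∀ j k {s d t} → 𝟘^ k ++ 𝟙 ∷ s ≡ 𝟘^ j ++ d ∷ t → RunEdge d j k
run-edge zero    zero    refl = refl
run-edge zero    (suc k) refl = s≤s z≤n
run-edge (suc j) (suc k) {d = d} eq = RunEdge-suc d (run-edge j k (∷-injectiveʳ eq))

RunEdge⇒prefix : ∀ c j k → RunEdge c j k → ∃[ t ] (𝟘^ k ++ [ 𝟙 ] ≡ 𝟘^ j ++ c ∷ t)
RunEdge⇒prefix 𝟘 zero    (suc k) _          = 𝟘^ k ++ [ 𝟙 ] , refl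
RunEdge⇒prefix 𝟘 (suc j) (suc k) (s≤s j<k) = map₂ (cong (𝟘 ∷_)) (RunEdge⇒prefix 𝟘 j k j<k)
RunEdge⇒prefix 𝟙 j       _       refl       = [] , refl

RunEdge⇒suffix : ∀ c j k → RunEdge c j k → ∃[ s ] (𝟙 ∷ 𝟘^ k ≡ s ++ c ∷ 𝟘^ j)
RunEdge⇒suffix c j k edge with RunEdge⇒prefix c j k edge
... | t , eq = reverse t , (begin
  𝟙 ∷ 𝟘^ k                  ≡⟨ sym (reverse-𝟘^-++-∷ k 𝟙 []) ⟩
  reverse (𝟘^ k ++ [ 𝟙 ])   ≡⟨ cong reverse eq ⟩
  reverse (𝟘^ j ++ c ∷ t)   ≡⟨ reverse-𝟘^-++-∷ j c t ⟩
  reverse t ++ c ∷ 𝟘^ j     ∎)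
  where open ≡-Reasoning

locate-𝟙 : ∀ k {s w t} → 𝟘^ k ++ 𝟙 ∷ s ≡ w ++ 𝟙 ∷ t →
  (w ≡ 𝟘^ k × s ≡ t) ⊎ ∃[ w′ ] (w ≡ 𝟘^ k ++ 𝟙 ∷ w′ × s ≡ w′ ++ 𝟙 ∷ t)
locate-𝟙 zero    {w = []}     refl = inj₁ (refl , refl)
locate-𝟙 zero    {w = 𝟙 ∷ w′} refl = inj₂ (w′ , refl , refl)
locate-𝟙 (suc k) {w = 𝟘 ∷ w}  eq with locate-𝟙 k (∷-injectiveʳ eq)
... | inj₁ (refl , s≡t)     = inj₁ (refl , s≡t)
... | inj₂ (w′ , refl , s≡) = inj₂ (w′ , refl , s≡)

𝟘^-𝟙-injective : ∀ k j {s t} → 𝟘^ k ++ 𝟙 ∷ s ≡ 𝟘^ j ++ 𝟙 ∷ t → k ≡ j × s ≡ t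
𝟘^-𝟙-injective k j eq with run-edge j k eq
... | refl = refl , ∷-injectiveʳ (++-cancelˡ (𝟘^ k) _ _ eq)

𝟘^-prefix-≤ : ∀ k j {s y} → 𝟘^ k ++ 𝟙 ∷ s ≡ 𝟘^ j ++ y → j ≤ k
𝟘^-prefix-≤ k       zero    _  = z≤n
𝟘^-prefix-≤ (suc k) (suc j) eq = s≤s (𝟘^-prefix-≤ k j (∷-injectiveʳ eq))

𝟘^-across-𝟙 : ∀ k {s x j y} → 𝟘^ k ++ 𝟙 ∷ s ≡ x ++ 𝟘^ j ++ y → j ≤ k ⊎ ∃[ x′ ] (s ≡ x′ ++ 𝟘^ j ++ y)
𝟘^-across-𝟙 k       {x = []}     eq   = inj₁ (𝟘^-prefix-≤ k _ eq)
𝟘^-across-𝟙 zero    {x = 𝟙 ∷ x′} refl = inj₂ (x′ , refl)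
𝟘^-across-𝟙 (suc k) {x = 𝟘 ∷ x}  eq   = map₁ m≤n⇒m≤1+n (𝟘^-across-𝟙 k {x = x} (∷-injectiveʳ eq))

data RunView : Word → Set where
  zeros   : ∀ m → RunView (𝟘^ m)
  zeros-𝟙 : ∀ i r → RunView (𝟘^ i ++ 𝟙 ∷ r)

runView : ∀ p → RunView p
runView []      = zeros 0
runView (𝟙 ∷ r) = zeros-𝟙 0 r
runView (𝟘 ∷ p) with runView p
... | zeros m     = zeros (suc m)
... | zeros-𝟙 i r = zeros-𝟙 (suc i) r

palindrome-𝟘^𝟙-end : ∀ i r → Palindrome (𝟘^ i ++ 𝟙 ∷ r) → r ≡ 𝟘^ i ⊎ ∃[ w ] (r ≡ w ++ 𝟙 ∷ 𝟘^ i)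
palindrome-𝟘^𝟙-end i r pal with locate-𝟙 i (trans (sym pal) (reverse-𝟘^-++-∷ i 𝟙 r))
... | inj₁ (_ , r≡)     = inj₁ r≡
... | inj₂ (w , _ , r≡) = inj₂ (w , r≡)

lookupDefault-++ˡ : ∀ x {y i} → i < length x → lookupDefault (x ++ y) i ≡ lookupDefault x i
lookupDefault-++ˡ (c ∷ x) {i = zero}  _         = refl
lookupDefault-++ˡ (c ∷ x) {i = suc i} (s≤s i<) = lookupDefault-++ˡ x i<

lookupDefault-factor : ∀ x w y (j : Fin (length w)) → lookupDefault (x ++ w ++ y) (length x + toℕ j) ≡ lookup w j
lookupDefault-factor []      (c ∷ w) y zero    = refl
lookupDefault-factor []      (c ∷ w) y (suc j) = lookupDefault-factor [] w y j
lookupDefault-factor (c ∷ x) w       y j       = lookupDefault-factor x w y j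

index-in-factor : ∀ (x w y : Word) (j : Fin (length w)) → length x + toℕ j < length (x ++ w ++ y)
index-in-factor []      w y j = <-≤-trans (toℕ<n j) (length-++-≤ˡ w)
index-in-factor (c ∷ x) w y j = s≤s (index-in-factor x w y j)

prefix-at : ∀ v w → length w ≤ length v → (∀ j → lookupDefault v (toℕ j) ≡ lookup w j) → ∃[ y ] (v ≡ w ++ y)
prefix-at v       []      _       _ = v , refl
prefix-at (c ∷ v) (d ∷ w) (s≤s h) f with prefix-at v w h (f ∘ suc)
... | y , eq = y , cong₂ _∷_ (f zero) eq

factor-at : ∀ v i w → i + length w ≤ length v → (∀ j → lookupDefault v (i + toℕ j) ≡ lookup w j) → Factor w v
factor-at v       zero    w h       f = [] , prefix-at v w h f
factor-at (c ∷ v) (suc i) w (s≤s h) f with factor-at v i w h f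
... | x , y , eq = c ∷ x , y , cong (c ∷_) eq

module Desubstitution (a b : ℕ) where

  κ : Letter → ℕ
  κ 𝟘 = a
  κ 𝟙 = b

  φ-∷ : ∀ e v → φ a b (e ∷ v) ≡ 𝟘^ κ e ++ 𝟙 ∷ φ a b v
  φ-∷ 𝟘 v = ++-assoc (𝟘^ a) [ 𝟙 ] (φ a b v)
  φ-∷ 𝟙 v = ++-assoc (𝟘^ b) [ 𝟙 ] (φ a b v)

  φ-[_] : ∀ e → φ a b [ e ] ≡ 𝟘^ κ e ++ [ 𝟙 ]
  φ-[ e ] = φ-∷ e []

  φ-++ : ∀ x y → φ a b (x ++ y) ≡ φ a b x ++ φ a b y
  φ-++ = concatMap-++ (φ₁ a b)

  φ-∷-++ : ∀ e v w → φ a b (e ∷ v) ++ w ≡ 𝟘^ κ e ++ 𝟙 ∷ φ a b v ++ w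
  φ-∷-++ e v w = trans (cong (_++ w) (φ-∷ e v)) (++-assoc (𝟘^ κ e) (𝟙 ∷ φ a b v) w)

  φ-≢[] : ∀ {v} → v ≢ [] → φ a b v ≢ []
  φ-≢[] {[]}    v≢[] = ⊥-elim (v≢[] refl)
  φ-≢[] {e ∷ v} _    = ++-∷-≢[] (𝟘^ κ e) ∘ trans (sym (φ-∷ e v))

  factor-φ : ∀ {w v} → Factor w v → Factor (φ a b w) (φ a b v)
  factor-φ {w} (x , y , refl) = φ a b x , φ a b y , trans (φ-++ x (w ++ y)) (cong (φ a b x ++_) (φ-++ w y))

  length-φ : ∀ v → length v ≤ length (φ a b v)
  length-φ []      = z≤n
  length-φ (e ∷ v) = begin
    suc (length v)                            ≤⟨ s≤s (length-φ v) ⟩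
    suc (length (φ a b v))                    ≤⟨ m≤n+m _ (length (𝟘^ κ e)) ⟩
    length (𝟘^ κ e) + suc (length (φ a b v))  ≡⟨ length-++ (𝟘^ κ e) ⟨
    length (𝟘^ κ e ++ 𝟙 ∷ φ a b v)            ≡⟨ cong length (φ-∷ e v) ⟨
    length (φ a b (e ∷ v))                    ∎
    where open ≤-Reasoning

  φ-split-at-𝟙 : ∀ v {X Z} → φ a b v ≡ X ++ 𝟙 ∷ Z →
    ∃[ v₁ ] ∃[ e ] ∃[ v₂ ] (v ≡ v₁ ++ e ∷ v₂ × X ≡ φ a b v₁ ++ 𝟘^ κ e × Z ≡ φ a b v₂)
  φ-split-at-𝟙 []      {X} eq = ⊥-elim (++-∷-≢[] X (sym eq))
  φ-split-at-𝟙 (e ∷ v)     eq with locate-𝟙 (κ e) (trans (sym (φ-∷ e v)) eq)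
  ... | inj₁ (refl , refl) = [] , e , v , refl , refl , refl
  ... | inj₂ (w , refl , eq′) with φ-split-at-𝟙 v eq′
  ...   | v₁ , f , v₂ , refl , refl , refl = e ∷ v₁ , f , v₂ , refl ,
    trans (sym (++-assoc (𝟘^ κ e) (𝟙 ∷ φ a b v₁) (𝟘^ κ f))) (cong (_++ 𝟘^ κ f) (sym (φ-∷ e v₁))) , refl

  φ-edge-right : ∀ v {j d Z} → φ a b v ≡ 𝟘^ j ++ d ∷ Z → ∃[ e ] ∃[ v′ ] (v ≡ e ∷ v′ × RunEdge d j (κ e))
  φ-edge-right []      {j} eq = ⊥-elim (++-∷-≢[] (𝟘^ j) (sym eq))
  φ-edge-right (e ∷ v)     eq = e , v , refl , run-edge _ (κ e) (trans (sym (φ-∷ e v)) eq)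

  reverse-𝟙∷φ : ∀ v → reverse (𝟙 ∷ φ a b v) ≡ 𝟙 ∷ φ a b (reverse v)
  reverse-𝟙∷φ []      = refl
  reverse-𝟙∷φ (e ∷ v) = begin
    reverse (𝟙 ∷ φ a b (e ∷ v))                       ≡⟨ cong (reverse ∘ (𝟙 ∷_)) (φ-∷ e v) ⟩
    reverse ((𝟙 ∷ 𝟘^ κ e) ++ 𝟙 ∷ φ a b v)             ≡⟨ reverse-++ (𝟙 ∷ 𝟘^ κ e) (𝟙 ∷ φ a b v) ⟩
    reverse (𝟙 ∷ φ a b v) ++ reverse (𝟙 ∷ 𝟘^ κ e)     ≡⟨ cong₂ _++_ (reverse-𝟙∷φ v) (unfold-reverse 𝟙 (𝟘^ κ e)) ⟩
    𝟙 ∷ φ a b (reverse v) ++ reverse (𝟘^ κ e) ∷ʳ 𝟙    ≡⟨ cong (λ z → 𝟙 ∷ φ a b (reverse v) ++ z ∷ʳ 𝟙) (reverse-𝟘^ (κ e)) ⟩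
    𝟙 ∷ φ a b (reverse v) ++ 𝟘^ κ e ++ [ 𝟙 ]          ≡⟨ cong (λ z → 𝟙 ∷ φ a b (reverse v) ++ z) φ-[ e ] ⟨
    𝟙 ∷ φ a b (reverse v) ++ φ a b [ e ]              ≡⟨ cong (𝟙 ∷_) (φ-++ (reverse v) [ e ]) ⟨
    𝟙 ∷ φ a b (reverse v ∷ʳ e)                        ≡⟨ cong (λ z → 𝟙 ∷ φ a b z) (unfold-reverse e v) ⟨
    𝟙 ∷ φ a b (reverse (e ∷ v))                       ∎
    where open ≡-Reasoning

  -- Reversal turns the left border of a run into a right border.
  edge-before-run : ∀ X c j v k → X ++ c ∷ 𝟘^ j ≡ φ a b v ++ 𝟘^ k → RunEdge c j k
  edge-before-run X c j v k eq = run-edge j k (begin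
    𝟘^ k ++ 𝟙 ∷ φ a b (reverse v)               ≡⟨ cong₂ _++_ (reverse-𝟘^ k) (reverse-𝟙∷φ v) ⟨
    reverse (𝟘^ k) ++ reverse (𝟙 ∷ φ a b v)     ≡⟨ reverse-++ (𝟙 ∷ φ a b v) (𝟘^ k) ⟨
    reverse (𝟙 ∷ φ a b v ++ 𝟘^ k)               ≡⟨ cong (reverse ∘ (𝟙 ∷_)) eq ⟨
    reverse (𝟙 ∷ X ++ c ∷ 𝟘^ j)                 ≡⟨ reverse-++-∷ (𝟙 ∷ X) c (𝟘^ j) ⟩
    reverse (𝟘^ j) ++ c ∷ reverse (𝟙 ∷ X)       ≡⟨ cong (_++ c ∷ reverse (𝟙 ∷ X)) (reverse-𝟘^ j) ⟩
    𝟘^ j ++ c ∷ reverse (𝟙 ∷ X)                 ∎)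
    where open ≡-Reasoning

  φ-edge-left : ∀ v {X c j Z} → φ a b v ≡ X ++ c ∷ 𝟘^ j ++ 𝟙 ∷ Z →
    ∃[ v₁ ] ∃[ e ] ∃[ v₂ ] (v ≡ v₁ ++ e ∷ v₂ × Z ≡ φ a b v₂ × RunEdge c j (κ e))
  φ-edge-left v {X} {c} {j} {Z} eq with φ-split-at-𝟙 v (trans eq (sym (++-assoc X (c ∷ 𝟘^ j) (𝟙 ∷ Z))))
  ... | v₁ , e , v₂ , v≡ , X≡ , Z≡ = v₁ , e , v₂ , v≡ , Z≡ , edge-before-run X c j v₁ (κ e) X≡

  between-𝟙s : ∀ v {X w Z} → φ a b v ≡ X ++ 𝟙 ∷ w ++ 𝟙 ∷ Z → ∃[ u ] (w ++ [ 𝟙 ] ≡ φ a b u)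
  between-𝟙s v eq with φ-split-at-𝟙 v eq
  ... | _ , _ , v₂ , _ , _ , Z≡ with φ-split-at-𝟙 v₂ (sym Z≡)
  ...   | u , e , _ , _ , refl , _ = u ∷ʳ e , (begin
    (φ a b u ++ 𝟘^ κ e) ++ [ 𝟙 ]  ≡⟨ ++-assoc (φ a b u) (𝟘^ κ e) [ 𝟙 ] ⟩
    φ a b u ++ 𝟘^ κ e ++ [ 𝟙 ]    ≡⟨ cong (φ a b u ++_) φ-[ e ] ⟨
    φ a b u ++ φ a b [ e ]        ≡⟨ φ-++ u [ e ] ⟨
    φ a b (u ∷ʳ e)                ∎)
    where open ≡-Reasoning

  T-reverse : ∀ q → reverse (T a b q) ≡ T a b (reverse q)
  T-reverse q = begin
    reverse (𝟘^ b ++ (𝟙 ∷ φ a b q) ++ 𝟘^ b)                    ≡⟨ reverse-++ (𝟘^ b) ((𝟙 ∷ φ a b q) ++ 𝟘^ b) ⟩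
    reverse ((𝟙 ∷ φ a b q) ++ 𝟘^ b) ++ reverse (𝟘^ b)          ≡⟨ cong (_++ reverse (𝟘^ b)) (reverse-++ (𝟙 ∷ φ a b q) (𝟘^ b)) ⟩
    (reverse (𝟘^ b) ++ reverse (𝟙 ∷ φ a b q)) ++ reverse (𝟘^ b)
      ≡⟨ cong₂ (λ z z′ → (z ++ z′) ++ z) (reverse-𝟘^ b) (reverse-𝟙∷φ q) ⟩
    (𝟘^ b ++ 𝟙 ∷ φ a b (reverse q)) ++ 𝟘^ b                   ≡⟨ ++-assoc (𝟘^ b) (𝟙 ∷ φ a b (reverse q)) (𝟘^ b) ⟩
    T a b (reverse q)                                         ∎
    where open ≡-Reasoning

  length-T : ∀ q → length q < length (T a b q)
  length-T q = begin-strict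
    length q                                      ≤⟨ length-φ q ⟩
    length (φ a b q)                              ≤⟨ length-++-≤ˡ (φ a b q) ⟩
    length (φ a b q ++ 𝟘^ b)                      <⟨ m≤n+m _ (length (𝟘^ b)) ⟩
    length (𝟘^ b) + length (𝟙 ∷ φ a b q ++ 𝟘^ b)  ≡⟨ length-++ (𝟘^ b) ⟨
    length (T a b q)                              ∎
    where open ≤-Reasoning

  module _ (b<a : b < a) where

    κ≤a : ∀ e → κ e ≤ a
    κ≤a 𝟘 = ≤-refl
    κ≤a 𝟙 = <⇒≤ b<a

    κ-injective : ∀ e f → κ e ≡ κ f → e ≡ f
    κ-injective 𝟘 𝟘 _   = refl
    κ-injective 𝟙 𝟙 _   = refl
    κ-injective 𝟘 𝟙 a≡b = ⊥-elim (<-irrefl (sym a≡b) b<a)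
    κ-injective 𝟙 𝟘 b≡a = ⊥-elim (<-irrefl b≡a b<a)

    φ-cancelˡ : ∀ q v {Z} → φ a b v ≡ φ a b q ++ Z → ∃[ v′ ] (v ≡ q ++ v′ × φ a b v′ ≡ Z)
    φ-cancelˡ []      v           eq = v , refl , eq
    φ-cancelˡ (c ∷ q) []      {Z} eq = ⊥-elim (++-∷-≢[] (𝟘^ κ c) (sym (trans eq (φ-∷-++ c q Z))))
    φ-cancelˡ (c ∷ q) (e ∷ v) {Z} eq
      with 𝟘^-𝟙-injective (κ e) (κ c) (trans (sym (φ-∷ e v)) (trans eq (φ-∷-++ c q Z)))
    ... | κe≡κc , eq′ with κ-injective e c κe≡κc | φ-cancelˡ q v eq′
    ...   | refl | v′ , refl , Z≡ = v′ , refl , Z≡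

    φ-injective : ∀ {q q′} → φ a b q ≡ φ a b q′ → q ≡ q′
    φ-injective {q} {q′} eq with φ-cancelˡ q q′ (trans (sym eq) (sym (++-identityʳ (φ a b q))))
    ... | []     , q′≡ , _    = sym (trans q′≡ (++-identityʳ q))
    ... | e ∷ v′ , _   , φ≡[] = ⊥-elim (φ-≢[] {e ∷ v′} (λ ()) φ≡[])

    T-injective : ∀ {q q′} → T a b q ≡ T a b q′ → q ≡ q′
    T-injective {q} {q′} eq =
      φ-injective (++-cancelʳ (𝟘^ b) (φ a b q) (φ a b q′) (∷-injectiveʳ (++-cancelˡ (𝟘^ b) _ _ eq)))

    palindrome-T⁻ : ∀ q → Palindrome (T a b q) → Palindrome q
    palindrome-T⁻ q pal = T-injective (trans (sym (T-reverse q)) pal)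

    𝟘^-in-φ-≤ : ∀ v {X j Y} → φ a b v ≡ X ++ 𝟘^ j ++ Y → j ≤ a
    𝟘^-in-φ-≤ []      {[]} {zero} _ = z≤n
    𝟘^-in-φ-≤ (e ∷ v) {X}         eq with 𝟘^-across-𝟙 (κ e) {x = X} (trans (sym (φ-∷ e v)) eq)
    ... | inj₁ j≤κe      = ≤-trans j≤κe (κ≤a e)
    ... | inj₂ (X′ , eq′) = 𝟘^-in-φ-≤ v {X′} eq′

    RunEdge-κ : ∀ c → RunEdge c b (κ c)
    RunEdge-κ 𝟘 = b<a
    RunEdge-κ 𝟙 = refl

    RunEdge-at-b : ∀ c e → RunEdge c b (κ e) → e ≡ c
    RunEdge-at-b 𝟘 𝟘 _   = refl
    RunEdge-at-b 𝟙 𝟙 _   = refl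
    RunEdge-at-b 𝟘 𝟙 b<b = ⊥-elim (<-irrefl refl b<b)
    RunEdge-at-b 𝟙 𝟘 b≡a = ⊥-elim (<-irrefl b≡a b<a)

    T-desubstitute : ∀ v {X c q d Y} → φ a b v ≡ X ++ c ∷ T a b q ++ d ∷ Y → Factor (c ∷ q ++ [ d ]) v
    T-desubstitute v {X} {c} {q} {d} {Y} eq
      with φ-edge-left v {Z = φ a b q ++ 𝟘^ b ++ d ∷ Y} (trans eq (solve 7
             (λ X C B O Q D Y → X ⊕ C ⊕ (B ⊕ O ⊕ Q ⊕ B) ⊕ D ⊕ Y ⊜ X ⊕ C ⊕ B ⊕ O ⊕ Q ⊕ B ⊕ D ⊕ Y)
             refl X [ c ] (𝟘^ b) [ 𝟙 ] (φ a b q) [ d ] Y))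
    ... | v₁ , e , v₂ , refl , Z≡ , edgeₗ with φ-cancelˡ q v₂ (sym Z≡)
    ...   | v₃ , refl , v₃≡ with φ-edge-right v₃ v₃≡
    ...     | f , v₄ , refl , edgeᵣ with RunEdge-at-b c e edgeₗ | RunEdge-at-b d f edgeᵣ
    ...       | refl | refl = v₁ , v₄ , cong (λ z → v₁ ++ c ∷ z) (sym (++-assoc q [ d ] v₄))

    RunEdges-≢⇒≡b : ∀ {c d j} e f → RunEdge c j (κ e) → RunEdge d j (κ f) → c ≢ d → j ≡ b
    RunEdges-≢⇒≡b {𝟘} {𝟘} _ _ _     _     c≢d = ⊥-elim (c≢d refl)
    RunEdges-≢⇒≡b {𝟙} {𝟙} _ _ _     _     c≢d = ⊥-elim (c≢d refl)
    RunEdges-≢⇒≡b {𝟘} {𝟙} e f j<κe  j≡κf  _   = border-is-b e f j<κe j≡κf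
      where
      border-is-b : ∀ {j} e f → j < κ e → j ≡ κ f → j ≡ b
      border-is-b e 𝟙 _    j≡b = j≡b
      border-is-b e 𝟘 j<κe j≡a = ⊥-elim (<-irrefl j≡a (<-≤-trans j<κe (κ≤a e)))
    RunEdges-≢⇒≡b {𝟙} {𝟘} e f j≡κe  j<κf  c≢d = RunEdges-≢⇒≡b {𝟘} {𝟙} f e j<κf j≡κe (c≢d ∘ sym)

module Language (a b : ℕ) (2≤a : 2 ≤ a) where
  open Desubstitution a b

  -- The factors of u_β, read off its prefixes φⁿ(0) rather than off uβ.
  ℒ : Word → Set
  ℒ w = ∃[ n ] Factor w (φ^ a b n [ 𝟘 ])

  φ^-++ : ∀ n x y → φ^ a b n (x ++ y) ≡ φ^ a b n x ++ φ^ a b n y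
  φ^-++ zero    x y = refl
  φ^-++ (suc n) x y = trans (cong (φ a b) (φ^-++ n x y)) (φ-++ (φ^ a b n x) (φ^ a b n y))

  φ^-suc : ∀ n w → φ^ a b (suc n) w ≡ φ^ a b n (φ a b w)
  φ^-suc zero    w = refl
  φ^-suc (suc n) w = cong (φ a b) (φ^-suc n w)

  φ^-≢[] : ∀ n {w} → w ≢ [] → φ^ a b n w ≢ []
  φ^-≢[] zero    = id
  φ^-≢[] (suc n) = φ-≢[] ∘ φ^-≢[] n

  ρ : Word
  ρ = 𝟘^ (a ∸ 2) ++ [ 𝟙 ]

  φ-𝟘 : φ a b [ 𝟘 ] ≡ 𝟘 ∷ 𝟘 ∷ ρ
  φ-𝟘 = trans φ-[ 𝟘 ] (cong (λ k → 𝟘^ k ++ [ 𝟙 ]) (sym (m+[n∸m]≡n 2≤a)))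

  φ^-suc-𝟘 : ∀ n → φ^ a b (suc n) [ 𝟘 ] ≡ φ^ a b n [ 𝟘 ] ++ φ^ a b n [ 𝟘 ] ++ φ^ a b n ρ
  φ^-suc-𝟘 n = begin
    φ^ a b (suc n) [ 𝟘 ]                                 ≡⟨ φ^-suc n [ 𝟘 ] ⟩
    φ^ a b n (φ a b [ 𝟘 ])                               ≡⟨ cong (φ^ a b n) φ-𝟘 ⟩
    φ^ a b n ([ 𝟘 ] ++ 𝟘 ∷ ρ)                            ≡⟨ φ^-++ n [ 𝟘 ] (𝟘 ∷ ρ) ⟩
    φ^ a b n [ 𝟘 ] ++ φ^ a b n ([ 𝟘 ] ++ ρ)              ≡⟨ cong (φ^ a b n [ 𝟘 ] ++_) (φ^-++ n [ 𝟘 ] ρ) ⟩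
    φ^ a b n [ 𝟘 ] ++ φ^ a b n [ 𝟘 ] ++ φ^ a b n ρ       ∎
    where open ≡-Reasoning

  φ^-prefix : ∀ {n m} → n ≤′ m → ∃[ t ] (φ^ a b m [ 𝟘 ] ≡ φ^ a b n [ 𝟘 ] ++ t)
  φ^-prefix (≤′-reflexive refl) = [] , sym (++-identityʳ _)
  φ^-prefix {n} (≤′-step {m} n≤′m) with φ^-prefix n≤′m
  ... | t , eq = t ++ φ^ a b m [ 𝟘 ] ++ φ^ a b m ρ ,
    trans (φ^-suc-𝟘 m) (trans (cong (_++ _) eq) (++-assoc (φ^ a b n [ 𝟘 ]) t _))

  length-φ^ : ∀ n → n < length (φ^ a b n [ 𝟘 ])
  length-φ^ zero    = s≤s z≤n
  length-φ^ (suc n) = begin-strict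
    suc n                                ≡⟨ +-comm 1 n ⟩
    n + 1                                <⟨ +-mono-<-≤ (length-φ^ n) 1≤|P++R| ⟩
    length P + length (P ++ φ^ a b n ρ)  ≡⟨ length-++ P ⟨
    length (P ++ P ++ φ^ a b n ρ)        ≡⟨ cong length (φ^-suc-𝟘 n) ⟨
    length (φ^ a b (suc n) [ 𝟘 ])        ∎
    where
    open ≤-Reasoning
    P : Word
    P = φ^ a b n [ 𝟘 ]
    1≤|P++R| : 1 ≤ length (P ++ φ^ a b n ρ)
    1≤|P++R| = ≤-trans (≤-<-trans z≤n (length-φ^ n)) (length-++-≤ˡ P)

  uβ-at : ∀ N i → i < length (φ^ a b N [ 𝟘 ]) → uβ a b i ≡ lookupDefault (φ^ a b N [ 𝟘 ]) i
  uβ-at N i i< with ≤-total N (suc i)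
  ... | inj₁ N≤ with φ^-prefix (≤⇒≤′ N≤)
  ...   | t , eq = trans (cong (λ z → lookupDefault z i) eq) (lookupDefault-++ˡ (φ^ a b N [ 𝟘 ]) i<)
  uβ-at N i i< | inj₂ ≤N with φ^-prefix (≤⇒≤′ ≤N)
  ...   | t , eq = sym (trans (cong (λ z → lookupDefault z i) eq)
                              (lookupDefault-++ˡ (φ^ a b (suc i) [ 𝟘 ]) (<-trans (n<1+n i) (length-φ^ (suc i)))))

  InL⇒ℒ : ∀ {w} → InL a b w → ℒ w
  InL⇒ℒ {w} (i , at-i) = N , factor-at (φ^ a b N [ 𝟘 ]) i w (<⇒≤ (length-φ^ N))
      (λ j → trans (sym (uβ-at N (i + toℕ j) (<-trans (+-monoʳ-< i (toℕ<n j)) (length-φ^ N)))) (at-i j))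
    where
    N : ℕ
    N = i + length w

  ℒ⇒InL : ∀ {w} → ℒ w → InL a b w
  ℒ⇒InL {w} (n , x , y , eq) = length x , λ j → begin
    uβ a b (length x + toℕ j)                       ≡⟨ uβ-at n _ (subst (λ z → _ < length z) (sym eq) (index-in-factor x w y j)) ⟩
    lookupDefault (φ^ a b n [ 𝟘 ]) (length x + toℕ j) ≡⟨ cong (λ z → lookupDefault z (length x + toℕ j)) eq ⟩
    lookupDefault (x ++ w ++ y) (length x + toℕ j)  ≡⟨ lookupDefault-factor x w y j ⟩
    lookup w j                                      ∎
    where open ≡-Reasoning

  ℒ-factor : ∀ {w v} → Factor w v → ℒ v → ℒ w
  ℒ-factor w⊑v (n , v⊑φⁿ) = n , factor-trans w⊑v v⊑φⁿ

  ℒ-φ : ∀ {w} → ℒ w → ℒ (φ a b w)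
  ℒ-φ (n , w⊑φⁿ) = suc n , factor-φ w⊑φⁿ

  ℒ-occurrence : ∀ {w} → ℒ w → ∃[ v ] (ℒ v × Factor w (φ a b v))
  ℒ-occurrence (n , w⊑φⁿ) = φ^ a b n [ 𝟘 ] , (n , factor-refl _) ,
    factor-trans w⊑φⁿ ([] , _ , φ^-suc-𝟘 n)

  ℒ-extend : ∀ {w} → ℒ w → ∃[ c ] ∃[ d ] ℒ (c ∷ w ++ [ d ])
  ℒ-extend {w} (n , x , y , eq) = extend (factor-extend (P ++ x) (y ++ R) P++x≢[] y++R≢[])
    where
    open ≡-Reasoning
    P R : Word
    P = φ^ a b n [ 𝟘 ]
    R = φ^ a b n ρ
    P++x≢[] : P ++ x ≢ []
    P++x≢[] = φ^-≢[] n (λ ()) ∘ ++-conicalˡ P x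
    y++R≢[] : y ++ R ≢ []
    y++R≢[] = φ^-≢[] n (++-∷-≢[] (𝟘^ (a ∸ 2))) ∘ ++-conicalʳ y R
    layout : φ^ a b (suc n) [ 𝟘 ] ≡ (P ++ x) ++ w ++ y ++ R
    layout = begin
      φ^ a b (suc n) [ 𝟘 ]     ≡⟨ φ^-suc-𝟘 n ⟩
      P ++ P ++ R              ≡⟨ cong (λ z → P ++ z ++ R) eq ⟩
      P ++ (x ++ w ++ y) ++ R  ≡⟨ solve 5 (λ P x w y R → P ⊕ (x ⊕ w ⊕ y) ⊕ R ⊜ (P ⊕ x) ⊕ w ⊕ (y ⊕ R)) refl P x w y R ⟩
      (P ++ x) ++ w ++ y ++ R  ∎
    extend : ∃[ c ] ∃[ d ] Factor (c ∷ w ++ [ d ]) ((P ++ x) ++ w ++ y ++ R) → ∃[ c ] ∃[ d ] ℒ (c ∷ w ++ [ d ])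
    extend (c , d , cwd⊑) = c , d , suc n , subst (Factor _) (sym layout) cwd⊑

  ℒ-extendˡ : ∀ {w} → ℒ w → ∃[ c ] ℒ (c ∷ w)
  ℒ-extendˡ w∈ℒ with ℒ-extend w∈ℒ
  ... | c , d , cwd∈ℒ = c , ℒ-factor ([] , [ d ] , refl) cwd∈ℒ

  𝟘^-∈ℒ : ∀ {j} → j ≤ a → ℒ (𝟘^ j)
  𝟘^-∈ℒ {j} j≤a = 1 , [] , 𝟘^ (a ∸ j) ++ [ 𝟙 ] , (begin
    φ a b [ 𝟘 ]                   ≡⟨ φ-[ 𝟘 ] ⟩
    𝟘^ a ++ [ 𝟙 ]                 ≡⟨ cong (λ k → 𝟘^ k ++ [ 𝟙 ]) (m+[n∸m]≡n j≤a) ⟨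
    𝟘^ (j + (a ∸ j)) ++ [ 𝟙 ]     ≡⟨ cong (_++ [ 𝟙 ]) (𝟘^-+ j (a ∸ j)) ⟩
    (𝟘^ j ++ 𝟘^ (a ∸ j)) ++ [ 𝟙 ] ≡⟨ ++-assoc (𝟘^ j) (𝟘^ (a ∸ j)) [ 𝟙 ] ⟩
    𝟘^ j ++ 𝟘^ (a ∸ j) ++ [ 𝟙 ]   ∎)
    where open ≡-Reasoning

  𝟙𝟘^a𝟙-∈ℒ : ℒ (𝟙 ∷ 𝟘^ a ++ [ 𝟙 ])
  𝟙𝟘^a𝟙-∈ℒ = ℒ-factor (𝟘^ a , [] , layout) (ℒ-φ (𝟘^-∈ℒ 2≤a))
    where
    layout : φ a b (𝟘^ 2) ≡ 𝟘^ a ++ (𝟙 ∷ 𝟘^ a ++ [ 𝟙 ]) ++ []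
    layout = trans (φ-∷ 𝟘 [ 𝟘 ]) (trans (cong (λ z → 𝟘^ a ++ 𝟙 ∷ z) φ-[ 𝟘 ])
                                        (sym (cong (𝟘^ a ++_) (++-identityʳ _))))

  ℒ-edge-left : ∀ {c j} → ℒ (c ∷ 𝟘^ j ++ [ 𝟙 ]) → ∃[ e ] RunEdge c j (κ e)
  ℒ-edge-left {c} {j} L with ℒ-occurrence L
  ... | v , _ , X , Y , eq with φ-edge-left v (trans eq (cong (λ z → X ++ c ∷ z) (++-assoc (𝟘^ j) [ 𝟙 ] Y)))
  ...   | _ , e , _ , _ , _ , edge = e , edge

  ℒ-edge-right : ∀ {d j} → ℒ (𝟙 ∷ 𝟘^ j ++ [ d ]) → ∃[ e ] RunEdge d j (κ e)
  ℒ-edge-right {d} {j} L with ℒ-occurrence L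
  ... | v , _ , X , Y , eq with φ-split-at-𝟙 v (trans eq (cong (λ z → X ++ 𝟙 ∷ z) (++-assoc (𝟘^ j) [ d ] Y)))
  ...   | _ , _ , v₂ , _ , _ , Z≡ with φ-edge-right v₂ (sym Z≡)
  ...     | e , _ , _ , edge = e , edge

module Palindromes (a b : ℕ) (b+1<a : b + 1 < a) where

  b<a : b < a
  b<a = <-trans (m<m+n b (s≤s z≤n)) b+1<a

  2≤a : 2 ≤ a
  2≤a = ≤-trans (s≤s (m≤n+m 1 b)) b+1<a

  1+[a∸1]≡a : suc (a ∸ 1) ≡ a
  1+[a∸1]≡a = m+[n∸m]≡n (≤-trans (s≤s z≤n) 2≤a)

  b<a∸1 : b < a ∸ 1
  b<a∸1 = subst (_≤ a ∸ 1) (+-comm b 1) (∸-monoˡ-≤ 1 b+1<a)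

  open Desubstitution a b
  open Language a b 2≤a

  Maximal : Word → Set
  Maximal p = ∀ c → ¬ ℒ (c ∷ p ++ [ c ])

  ¬InL⇒Maximal : ∀ {p} → ¬ InL a b (𝟘 ∷ p ++ [ 𝟘 ]) → ¬ InL a b (𝟙 ∷ p ++ [ 𝟙 ]) → Maximal p
  ¬InL⇒Maximal ¬𝟘p𝟘 _    𝟘 = ¬𝟘p𝟘 ∘ ℒ⇒InL
  ¬InL⇒Maximal _    ¬𝟙p𝟙 𝟙 = ¬𝟙p𝟙 ∘ ℒ⇒InL

  Maximal⇒¬InL : ∀ {p} c → Maximal p → ¬ InL a b (c ∷ p ++ [ c ])
  Maximal⇒¬InL c max = max c ∘ InL⇒ℒ

  -- φ(x c) ends with c 𝟘^b 𝟙 and φ(d) starts with 𝟘^b d; x is needed when c = 𝟙, whose block is just 𝟘^b 𝟙.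
  T-lift : ∀ c d q → ℒ (c ∷ q ++ [ d ]) → ℒ (c ∷ T a b q ++ [ d ])
  T-lift c d q cqd∈ℒ with ℒ-extendˡ cqd∈ℒ
                        | RunEdge⇒suffix c b (κ c) (RunEdge-κ b<a c)
                        | RunEdge⇒prefix d b (κ d) (RunEdge-κ b<a d)
  ... | x , xcqd∈ℒ | s , s≡ | t , t≡ = ℒ-factor (𝟘^ κ x ++ s , t , layout) (ℒ-φ xcqd∈ℒ)
    where
    open ≡-Reasoning
    layout : φ a b (x ∷ c ∷ q ++ [ d ]) ≡ (𝟘^ κ x ++ s) ++ (c ∷ T a b q ++ [ d ]) ++ t
    layout = begin
      φ a b (x ∷ c ∷ q ++ [ d ])
        ≡⟨ φ-∷ x (c ∷ q ++ [ d ]) ⟩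
      𝟘^ κ x ++ 𝟙 ∷ φ a b (c ∷ q ++ [ d ])
        ≡⟨ cong (λ z → 𝟘^ κ x ++ 𝟙 ∷ z) (φ-∷ c (q ++ [ d ])) ⟩
      𝟘^ κ x ++ 𝟙 ∷ 𝟘^ κ c ++ 𝟙 ∷ φ a b (q ++ [ d ])
        ≡⟨ cong (λ z → 𝟘^ κ x ++ 𝟙 ∷ 𝟘^ κ c ++ 𝟙 ∷ z) (trans (φ-++ q [ d ]) (cong (φ a b q ++_) φ-[ d ])) ⟩
      𝟘^ κ x ++ (𝟙 ∷ 𝟘^ κ c) ++ 𝟙 ∷ φ a b q ++ 𝟘^ κ d ++ [ 𝟙 ]
        ≡⟨ cong₂ (λ u u′ → 𝟘^ κ x ++ u ++ 𝟙 ∷ φ a b q ++ u′) s≡ t≡ ⟩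
      𝟘^ κ x ++ (s ++ c ∷ 𝟘^ b) ++ 𝟙 ∷ φ a b q ++ 𝟘^ b ++ d ∷ t
        ≡⟨ solve 8 (λ X S C B O Q D T → X ⊕ (S ⊕ C ⊕ B) ⊕ O ⊕ Q ⊕ B ⊕ D ⊕ T ⊜ (X ⊕ S) ⊕ (C ⊕ (B ⊕ O ⊕ Q ⊕ B) ⊕ D) ⊕ T)
             refl (𝟘^ κ x) s [ c ] (𝟘^ b) [ 𝟙 ] (φ a b q) [ d ] t ⟩
      (𝟘^ κ x ++ s) ++ (c ∷ T a b q ++ [ d ]) ++ t
        ∎

  T-lift⁻ : ∀ c d q → ℒ (c ∷ T a b q ++ [ d ]) → ℒ (c ∷ q ++ [ d ])
  T-lift⁻ c d q cTqd∈ℒ with ℒ-occurrence cTqd∈ℒ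
  ... | v , v∈ℒ , X , Y , eq =
    ℒ-factor (T-desubstitute b<a v (trans eq (cong (λ z → X ++ c ∷ z) (++-assoc (T a b q) [ d ] Y)))) v∈ℒ

  maximal-T : ∀ q → Maximal q → Maximal (T a b q)
  maximal-T q max c = max c ∘ T-lift⁻ c c q

  maximal-T⁻ : ∀ q → Maximal (T a b q) → Maximal q
  maximal-T⁻ q max c = max c ∘ T-lift c c q

  ℒ-T⁻ : ∀ q → ℒ (T a b q) → ℒ q
  ℒ-T⁻ q Tq∈ℒ with ℒ-extend Tq∈ℒ
  ... | c , d , cTqd∈ℒ = ℒ-factor ([ c ] , [ d ] , refl) (T-lift⁻ c d q cTqd∈ℒ)

  ℒ-𝟘^-≤ : ∀ {m} → ℒ (𝟘^ m) → m ≤ a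
  ℒ-𝟘^-≤ 𝟘^m∈ℒ with ℒ-occurrence 𝟘^m∈ℒ
  ... | v , _ , X , Y , eq = 𝟘^-in-φ-≤ b<a v {X} {_} {Y} eq

  maximal-𝟘^a∸1 : Maximal (𝟘^ (a ∸ 1))
  maximal-𝟘^a∸1 𝟘 L = n≮n a (subst (_≤ a) (cong suc 1+[a∸1]≡a) (ℒ-𝟘^-≤ (subst ℒ (𝟘∷𝟘^-∷ʳ𝟘 (a ∸ 1)) L)))
  maximal-𝟘^a∸1 𝟙 L with ℒ-edge-right L
  ... | 𝟘 , a∸1≡a = <-irrefl a∸1≡a (subst (a ∸ 1 <_) 1+[a∸1]≡a (n<1+n (a ∸ 1)))
  ... | 𝟙 , a∸1≡b = <-irrefl (sym a∸1≡b) b<a∸1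

  U-maximal : ∀ n → Maximal (U a b (suc n))
  U-maximal zero    = maximal-𝟘^a∸1
  U-maximal (suc n) = maximal-T (U a b (suc n)) (U-maximal n)

  maximal-𝟘^⇒a∸1 : ∀ m → ℒ (𝟘^ m) → Maximal (𝟘^ m) → m ≡ a ∸ 1
  maximal-𝟘^⇒a∸1 m 𝟘^m∈ℒ max with m≤n⇒m<n∨m≡n (ℒ-𝟘^-≤ 𝟘^m∈ℒ)
  ... | inj₂ refl = ⊥-elim (max 𝟙 𝟙𝟘^a𝟙-∈ℒ)
  ... | inj₁ m<a with m≤n⇒m<n∨m≡n (∸-monoˡ-≤ 1 m<a)
  ...   | inj₂ m≡a∸1  = m≡a∸1
  ...   | inj₁ m<a∸1 =
    ⊥-elim (max 𝟘 (subst ℒ (sym (𝟘∷𝟘^-∷ʳ𝟘 m)) (𝟘^-∈ℒ (subst (suc (suc m) ≤_) 1+[a∸1]≡a (s≤s m<a∸1)))))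

  maximal-𝟘^𝟙-run≡b : ∀ i r → Palindrome (𝟘^ i ++ 𝟙 ∷ r) → ℒ (𝟘^ i ++ 𝟙 ∷ r) → Maximal (𝟘^ i ++ 𝟙 ∷ r) → i ≡ b
  maximal-𝟘^𝟙-run≡b i r pal p∈ℒ max = borders (ℒ-extend p∈ℒ)
    where
    p : Word
    p = 𝟘^ i ++ 𝟙 ∷ r
    left : ∀ c d → Factor (c ∷ 𝟘^ i ++ [ 𝟙 ]) (c ∷ p ++ [ d ])
    left c d = [] , r ++ [ d ] ,
      solve 5 (λ C Z O R D → C ⊕ (Z ⊕ O ⊕ R) ⊕ D ⊜ (C ⊕ Z ⊕ O) ⊕ R ⊕ D) refl [ c ] (𝟘^ i) [ 𝟙 ] r [ d ]
    right : ∀ c d → Factor (𝟙 ∷ 𝟘^ i ++ [ d ]) (c ∷ p ++ [ d ])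
    right c d = c ∷ reverse r , [] , (begin
      c ∷ p ++ [ d ]                                ≡⟨ cong (λ z → c ∷ z ++ [ d ]) (sym pal) ⟩
      c ∷ reverse p ++ [ d ]                        ≡⟨ cong (λ z → c ∷ z ++ [ d ]) (reverse-𝟘^-++-∷ i 𝟙 r) ⟩
      c ∷ (reverse r ++ 𝟙 ∷ 𝟘^ i) ++ [ d ]          ≡⟨ solve 5 (λ C R O Z D → C ⊕ (R ⊕ O ⊕ Z) ⊕ D ⊜ (C ⊕ R) ⊕ (O ⊕ Z ⊕ D))
                                                         refl [ c ] (reverse r) [ 𝟙 ] (𝟘^ i) [ d ] ⟩
      (c ∷ reverse r) ++ 𝟙 ∷ 𝟘^ i ++ [ d ]          ≡⟨ cong ((c ∷ reverse r) ++_) (++-identityʳ _) ⟨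
      (c ∷ reverse r) ++ (𝟙 ∷ 𝟘^ i ++ [ d ]) ++ []  ∎)
      where open ≡-Reasoning
    borders : ∃[ c ] ∃[ d ] ℒ (c ∷ p ++ [ d ]) → i ≡ b
    borders (c , d , cpd∈ℒ) = agree (ℒ-edge-left (ℒ-factor (left c d) cpd∈ℒ)) (ℒ-edge-right (ℒ-factor (right c d) cpd∈ℒ))
      where
      c≢d : c ≢ d
      c≢d refl = max c cpd∈ℒ
      agree : ∃[ e ] RunEdge c i (κ e) → ∃[ f ] RunEdge d i (κ f) → i ≡ b
      agree (e , edgeₗ) (f , edgeᵣ) = RunEdges-≢⇒≡b b<a e f edgeₗ edgeᵣ c≢d

  palindrome-𝟘^𝟙-desubst : ∀ i r → Palindrome (𝟘^ i ++ 𝟙 ∷ r) → ℒ (𝟘^ i ++ 𝟙 ∷ r) → ∃[ q ] (r ≡ φ a b q ++ 𝟘^ i)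
  palindrome-𝟘^𝟙-desubst i r pal p∈ℒ with palindrome-𝟘^𝟙-end i r pal
  ... | inj₁ r≡𝟘^i      = [] , r≡𝟘^i
  ... | inj₂ (w , refl) with ℒ-occurrence p∈ℒ
  ...   | v , _ , X , Y , eq with between-𝟙s v (trans eq (solve 5
            (λ X Z O W Y → X ⊕ (Z ⊕ O ⊕ W ⊕ O ⊕ Z) ⊕ Y ⊜ (X ⊕ Z) ⊕ O ⊕ W ⊕ O ⊕ (Z ⊕ Y))
            refl X (𝟘^ i) [ 𝟙 ] w Y))
  ...     | u , w𝟙≡φu = u , trans (sym (++-assoc w [ 𝟙 ] (𝟘^ i))) (cong (_++ 𝟘^ i) w𝟙≡φu)

  maximal-𝟘^𝟙-is-T : ∀ i r → Palindrome (𝟘^ i ++ 𝟙 ∷ r) → ℒ (𝟘^ i ++ 𝟙 ∷ r) → Maximal (𝟘^ i ++ 𝟙 ∷ r) →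
    ∃[ q ] (𝟘^ i ++ 𝟙 ∷ r ≡ T a b q)
  maximal-𝟘^𝟙-is-T i r pal p∈ℒ max =
    let q , r≡ = palindrome-𝟘^𝟙-desubst i r pal p∈ℒ
    in q , subst (λ j → 𝟘^ i ++ 𝟙 ∷ r ≡ 𝟘^ j ++ 𝟙 ∷ (φ a b q ++ 𝟘^ j)) (maximal-𝟘^𝟙-run≡b i r pal p∈ℒ max)
                 (cong (λ z → 𝟘^ i ++ 𝟙 ∷ z) r≡)

  maximal-palindrome-shape : ∀ p → Palindrome p → ℒ p → Maximal p → p ≡ 𝟘^ (a ∸ 1) ⊎ ∃[ q ] (p ≡ T a b q)
  maximal-palindrome-shape p pal p∈ℒ max with runView p
  ... | zeros m     = inj₁ (cong 𝟘^_ (maximal-𝟘^⇒a∸1 m p∈ℒ max))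
  ... | zeros-𝟙 i r = inj₂ (maximal-𝟘^𝟙-is-T i r pal p∈ℒ max)

  _⊏_ : Word → Word → Set
  _⊏_ = _<_ on length

  maximal⇒U : ∀ p → Acc _⊏_ p → Palindrome p → ℒ p → Maximal p → ∃[ n ] (p ≡ U a b (suc n))
  maximal⇒U p (acc shorter) pal p∈ℒ max with maximal-palindrome-shape p pal p∈ℒ max
  ... | inj₁ p≡𝟘^a∸1  = 0 , p≡𝟘^a∸1
  ... | inj₂ (q , refl) =
    let n , q≡U = maximal⇒U q (shorter (length-T q)) (palindrome-T⁻ b<a q pal) (ℒ-T⁻ q p∈ℒ) (maximal-T⁻ q max)
    in suc n , cong (T a b) q≡U

proposition5p4 : (a b : ℕ) → 1 ≤ b → b + 1 < a →
    (p : Word) → Palindrome p → InL a b p →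
    (MaximalPalindrome a b p → ∃[ n ] (1 ≤ n × p ≡ U a b n)) ×
    (∃[ n ] (1 ≤ n × p ≡ U a b n) → MaximalPalindrome a b p)
proposition5p4 a b _ b+1<a p pal p∈L = maximal⇒U′ , U⇒maximal
  where
  open Palindromes a b b+1<a
  open Language a b 2≤a using (InL⇒ℒ)

  maximal⇒U′ : MaximalPalindrome a b p → ∃[ n ] (1 ≤ n × p ≡ U a b n)
  maximal⇒U′ (_ , _ , ¬𝟘p𝟘 , ¬𝟙p𝟙) =
    let n , p≡U = maximal⇒U p (wellFounded length <-wellFounded p) pal (InL⇒ℒ p∈L) (¬InL⇒Maximal ¬𝟘p𝟘 ¬𝟙p𝟙)
    in suc n , s≤s z≤n , p≡U

  U⇒maximal : ∃[ n ] (1 ≤ n × p ≡ U a b n) → MaximalPalindrome a b p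
  U⇒maximal (suc n , _ , refl) = pal , p∈L , Maximal⇒¬InL 𝟘 (U-maximal n) , Maximal⇒¬InL 𝟙 (U-maximal n)
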